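{- Let $b\ge3$ be odd, let $a=a(b,i)$ be an odd element of $RRS^*(b)$, and let $MDS(b,i)=(c_1,\dots,c_P)$ be the primitive period of $c_j=\mathrm{mod}^*(a2^j,b)$, $j\ge1$. - Let $co_1,\dots,co_{r^*}$ be the odd entries of $MDS(b,i)$ in their order of occurrence. - Let $l'_1,\dots,l'_{r^*}$ be defined as follows. Form $MDS'(b,i)=(a,c_1,\dots,c_{P-1})$, with indices $0,1,\dots,P-1$. Let $co'_0=a,co'_1,\dots,co'_{r^*-1}$ be its odd entries in order. Put $l'_j=\mathrm{ind}(co'_j)-\mathrm{ind}(co'_{j-1})$ for $j=1,\dots,r^*$, with $\mathrm{ind}(co'_{r^*}):=P$. Then $$co_1=b-2^{\,l'_1}\,a,\qquad co_j=b-2^{\,l'_j}\,co_{j-1}\quad (j=2,\dots,r^*).$$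
   Context: For odd $b\ge3$: - $RRS^*(b)=\{r\in\mathbb Z:1\le r\le(b-1)/2,\ \gcd(r,b)=1\}$. - For $m$ coprime to $b$, $\mathrm{mod}^*(m,b)=\mathrm{mod}(m,b)$ if the least non-negative residue $\mathrm{mod}(m,b)$ is $\le b/2$, and $\mathrm{mod}^*(m,b)=\mathrm{mod}(-m,b)$ otherwise. - The sequence $(\mathrm{mod}^*(a2^j,b))_{j\ge1}$ is purely periodic with primitive period $P$, and $c_P=a$. - $a(b,i)$ is the $i$-th input of the complete MDS system: $a(b,1)=1$, and each further input is the smallest odd element of $RRS^*(b)$ not yet occurring in previously generated sequences. -}

module Defs where

open import Data.Bool using (Bool; if_then_else_)
open import Data.Nat using (ℕ; zero; suc; _+_; _*_; _∸_; _^_; _≤_; _<_; _≤ᵇ_; _≡ᵇ_; NonZero)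
open import Data.Nat.DivMod using (_%_; _/_)
open import Data.Nat.Coprimality using (Coprime)
open import Data.Integer as ℤ using (ℤ; +_)
open import Data.List using (List; []; _∷_; map; upTo; filterᵇ; _++_; zipWith)
open import Data.Product using (_×_)
open import Data.Unit using (⊤)
open import Data.Empty using (⊥)
open import Relation.Binary.PropositionalEquality using (_≡_)

Odd : ℕ → Set
Odd n = n % 2 ≡ 1

isOdd : ℕ → Bool
isOdd n = (n % 2) ≡ᵇ 1

InRRS* : ℕ → ℕ → Set
InRRS* b r = 1 ≤ r × r ≤ (b ∸ 1) / 2 × Coprime r b

modStar : (m b : ℕ) .{{_ : NonZero b}} → ℕ
modStar m b = if (2 * (m % b)) ≤ᵇ b then m % b else b ∸ (m % b)

cSeq : (b a : ℕ) .{{_ : NonZero b}} → ℕ → ℕ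
cSeq b a j = modStar (a * 2 ^ j) b

HasPeriod : (ℕ → ℕ) → ℕ → Set
HasPeriod c Q = 1 ≤ Q × (∀ j → 1 ≤ j → c (j + Q) ≡ c j)

IsPrimitivePeriod : (ℕ → ℕ) → ℕ → Set
IsPrimitivePeriod c P = HasPeriod c P × (∀ Q → Q < P → HasPeriod c Q → ⊥)

MDS : (b a P : ℕ) .{{_ : NonZero b}} → List ℕ
MDS b a P = map (λ k → cSeq b a (suc k)) (upTo P)

oddEntries : (b a P : ℕ) .{{_ : NonZero b}} → List ℕ
oddEntries b a P = filterᵇ isOdd (MDS b a P)

mds'Entry : (b a : ℕ) .{{_ : NonZero b}} → ℕ → ℕ
mds'Entry b a zero = a
mds'Entry b a (suc k) = cSeq b a (suc k)

-- ind(co'_0), ..., ind(co'_{r*-1}), followed by ind(co'_{r*}) := P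
oddIndices' : (b a P : ℕ) .{{_ : NonZero b}} → List ℕ
oddIndices' b a P = filterᵇ (λ k → isOdd (mds'Entry b a k)) (upTo P) ++ (P ∷ [])

-- consecutive differences: (x_1 - x_0, x_2 - x_1, ...)
diffs : List ℕ → List ℕ
diffs [] = []
diffs (x ∷ xs) = zipWith _∸_ xs (x ∷ xs)

lPrime : (b a P : ℕ) .{{_ : NonZero b}} → List ℕ
lPrime b a P = diffs (oddIndices' b a P)

Recurrence : ℕ → ℕ → List ℕ → List ℕ → Set
Recurrence b prev [] [] = ⊤
Recurrence b prev (co ∷ cos) (l ∷ ls) =
  (+ co ≡ (+ b) ℤ.- (+ (2 ^ l * prev))) × Recurrence b co cos ls
Recurrence b prev [] (_ ∷ _) = ⊥
Recurrence b prev (_ ∷ _) [] = ⊥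

-- Since a ≤ b/2, one step c_j ↦ c_{j+1} of mod*(a 2^j, b) either doubles (c_{j+1} = 2 c_j, which is
-- even) or doubles and reflects (c_{j+1} = b − 2 c_j, which is odd because b is). So between two odd
-- entries the sequence just doubles, l times say, and the next odd entry is b − 2^l times the previous
-- one. The chain starts at c_0 = a, and c_P = c_0 is odd too, because the step relation determines
-- c_j from c_{j+1}; this closes the list of indices with ind(co'_{r*}) = P.
module Submission where

open import Defs
open import Data.Bool using (Bool; true; false; if_then_else_; T)
open import Data.Nat
open import Data.Nat.Properties
open import Data.Nat.DivMod
open import Algebra.Properties.CommutativeSemigroup *-commutativeSemigroup using (x∙yz≈y∙xz)
open import Data.Integer as ℤ using (_⊖_)
open import Data.Integer.Properties using (m-n≡m⊖n; ⊖-≥)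
open import Data.List using (List; []; _∷_; map; upTo; applyUpTo; filterᵇ; _++_)
open import Data.List.Properties using (map-∘; map-upTo; upTo-∷ʳ; filter-++)
open import Data.Product using (_,_)
open import Data.Sum using (_⊎_; inj₁; inj₂; [_,_]′)
open import Data.Unit using (tt)
open import Data.Empty using (⊥-elim)
open import Function using (_∘_)
open import Relation.Binary.PropositionalEquality
open import Relation.Nullary using (yes; no)
open import Relation.Nullary.Decidable using (T?)

-- modStar m b is fold b (m % b) by definition.
fold : ℕ → ℕ → ℕ
fold b r = if 2 * r ≤ᵇ b then r else b ∸ r

fold-≤ : ∀ {b r} → 2 * r ≤ b → fold b r ≡ r
fold-≤ {b} {r} 2r≤b with 2 * r ≤ᵇ b | ≤⇒≤ᵇ 2r≤b
... | true | _ = refl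

fold-+ : ∀ {b r} → r ≤ b → b ≤ 2 * r → fold b r + r ≡ b
fold-+ {b} {r} r≤b b≤2r with 2 * r ≤ᵇ b in eq
... | false = m∸n+n≡m r≤b
... | true  = begin
  r + r        ≡⟨ cong (r +_) (sym (+-identityʳ r)) ⟩
  2 * r        ≡⟨ ≤-antisym (≤ᵇ⇒≤ (2 * r) b (subst T (sym eq) tt)) b≤2r ⟩
  b            ∎
  where open ≡-Reasoning

fold-cases : ∀ {b r} → r ≤ b → fold b r ≡ r ⊎ fold b r + r ≡ b
fold-cases {b} {r} r≤b with ≤-total (2 * r) b
... | inj₁ 2r≤b = inj₁ (fold-≤ 2r≤b)
... | inj₂ b≤2r = inj₂ (fold-+ r≤b b≤2r)

data FoldedDouble (b x y : ℕ) : Set where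
  doubled   : y ≡ 2 * x → FoldedDouble b x y
  reflected : y + 2 * x ≡ b → FoldedDouble b x y

2r%b+b≡2r : ∀ {b r} .{{_ : NonZero b}} → r < b → b ≤ 2 * r → (2 * r) % b + b ≡ 2 * r
2r%b+b≡2r {b} {r} r<b b≤2r = begin
  (2 * r) % b + b        ≡⟨ cong (_+ b) (sym (m≤n⇒[n∸m]%m≡n%m b≤2r)) ⟩
  (2 * r ∸ b) % b + b    ≡⟨ cong (_+ b) (m<n⇒m%n≡m 2r∸b<b) ⟩
  2 * r ∸ b + b          ≡⟨ m∸n+n≡m b≤2r ⟩
  2 * r                  ∎
  where
  open ≡-Reasoning
  2r∸b<b : 2 * r ∸ b < b
  2r∸b<b = m<n+o⇒m∸n<o (2 * r) b
    (subst (2 * r <_) (cong (b +_) (+-identityʳ b)) (*-monoʳ-< 2 r<b))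

fold-double-wrapped : ∀ {b f r s g} → f + r ≡ b → s + b ≡ 2 * r →
                      g ≡ s ⊎ g + s ≡ b → FoldedDouble b f g
fold-double-wrapped {b} {f} {r} {s} {g} f+r≡b s+b≡2r (inj₁ g≡s) =
  reflected (+-cancelʳ-≡ (2 * r) _ _ (begin
    g + 2 * f + 2 * r    ≡⟨ +-assoc g (2 * f) (2 * r) ⟩
    g + (2 * f + 2 * r)  ≡⟨ cong₂ _+_ g≡s (sym (*-distribˡ-+ 2 f r)) ⟩
    s + 2 * (f + r)      ≡⟨ cong (λ x → s + 2 * x) f+r≡b ⟩
    s + (b + (b + 0))    ≡⟨ sym (+-assoc s b (b + 0)) ⟩
    s + b + (b + 0)      ≡⟨ cong₂ _+_ s+b≡2r (+-identityʳ b) ⟩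
    2 * r + b            ≡⟨ +-comm (2 * r) b ⟩
    b + 2 * r            ∎))
  where open ≡-Reasoning
fold-double-wrapped {b} {f} {r} {s} {g} f+r≡b s+b≡2r (inj₂ g+s≡b) =
  doubled (+-cancelʳ-≡ (2 * r) _ _ (begin
    g + 2 * r            ≡⟨ cong (g +_) (sym s+b≡2r) ⟩
    g + (s + b)          ≡⟨ sym (+-assoc g s b) ⟩
    g + s + b            ≡⟨ cong (_+ b) g+s≡b ⟩
    b + b                ≡⟨ cong (b +_) (sym (+-identityʳ b)) ⟩
    2 * b                ≡⟨ cong (2 *_) (sym f+r≡b) ⟩
    2 * (f + r)          ≡⟨ *-distribˡ-+ 2 f r ⟩
    2 * f + 2 * r        ∎))
  where open ≡-Reasoning

fold-double : ∀ {b r} .{{_ : NonZero b}} → r < b → FoldedDouble b (fold b r) (fold b ((2 * r) % b))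
fold-double {b} {r} r<b with 2 * r <? b
... | yes 2r<b = subst₂ (FoldedDouble b) (sym (fold-≤ {b} {r} (<⇒≤ 2r<b)))
                   (cong (fold b) (sym (m<n⇒m%n≡m 2r<b)))
                   ([ doubled , reflected ]′ (fold-cases (<⇒≤ 2r<b)))
... | no 2r≮b = fold-double-wrapped {f = fold b r} {r} (fold-+ (<⇒≤ r<b) b≤2r) (2r%b+b≡2r r<b b≤2r)
                  (fold-cases {b} {(2 * r) % b} (<⇒≤ (m%n<n (2 * r) b)))
  where
  b≤2r : b ≤ 2 * r
  b≤2r = ≮⇒≥ 2r≮b

cSeq-suc : ∀ b .{{_ : NonZero b}} a k → FoldedDouble b (cSeq b a k) (cSeq b a (suc k))
cSeq-suc b a k = subst (FoldedDouble b (fold b (m % b)) ∘ fold b) (sym a2^[1+k]%b≡2[m%b]%b)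
                   (fold-double (m%n<n m b))
  where
  open ≡-Reasoning
  m : ℕ
  m = a * 2 ^ k
  a2^[1+k]%b≡2[m%b]%b : (a * 2 ^ suc k) % b ≡ (2 * (m % b)) % b
  a2^[1+k]%b≡2[m%b]%b = begin
    (a * (2 * 2 ^ k)) % b      ≡⟨ cong (_% b) (x∙yz≈y∙xz a 2 (2 ^ k)) ⟩
    (2 * m) % b                ≡⟨ %-distribˡ-* 2 m b ⟩
    (2 % b * (m % b)) % b      ≡⟨ cong (λ x → (2 % b * x) % b) (sym (m%n%n≡m%n m b)) ⟩
    (2 % b * (m % b % b)) % b  ≡⟨ sym (%-distribˡ-* 2 (m % b) b) ⟩
    (2 * (m % b)) % b          ∎

cSeq-zero : ∀ b .{{_ : NonZero b}} a → InRRS* b a → cSeq b a 0 ≡ a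
cSeq-zero b a (_ , a≤[b∸1]/2 , _) = begin
  fold b ((a * 1) % b)  ≡⟨ cong (λ x → fold b (x % b)) (*-identityʳ a) ⟩
  fold b (a % b)        ≡⟨ cong (fold b) (m<n⇒m%n≡m a<b) ⟩
  fold b a              ≡⟨ fold-≤ (≤-trans 2a≤b∸1 (m∸n≤m b 1)) ⟩
  a                     ∎
  where
  open ≡-Reasoning
  2a≤b∸1 : 2 * a ≤ b ∸ 1
  2a≤b∸1 = ≤-trans (*-monoʳ-≤ 2 a≤[b∸1]/2)
             (subst (_≤ b ∸ 1) (*-comm ((b ∸ 1) / 2) 2) (m/n*n≤m (b ∸ 1) 2))
  a<b : a < b
  a<b = ≤-<-trans (≤-trans (m≤n*m a 2) 2a≤b∸1) (∸-monoʳ-< z<s (>-nonZero⁻¹ b))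

true≢false : true ≢ false
true≢false ()

Odd⇒isOdd : ∀ {n} → Odd n → isOdd n ≡ true
Odd⇒isOdd odd = cong (_≡ᵇ 1) odd

isOdd-double : ∀ x → isOdd (2 * x) ≡ false
isOdd-double x = cong (_≡ᵇ 1) (trans (cong (_% 2) (*-comm 2 x)) (m*n%n≡0 x 2))

isOdd-+-double : ∀ y x → isOdd (y + 2 * x) ≡ isOdd y
isOdd-+-double y x = cong (_≡ᵇ 1) (trans (cong (λ z → (y + z) % 2) (*-comm 2 x)) ([m+kn]%n≡m%n y x 2))

module _ {b : ℕ} (b-odd : isOdd b ≡ true) where

  complement-isOdd : ∀ x y → y + 2 * x ≡ b → isOdd y ≡ true
  complement-isOdd x y y+2x≡b = trans (sym (isOdd-+-double y x)) (trans (cong isOdd y+2x≡b) b-odd)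

  double-isEven : ∀ x y → y ≡ 2 * x → isOdd y ≡ false
  double-isEven x y y≡2x = trans (cong isOdd y≡2x) (isOdd-double x)

  foldedDouble-odd : ∀ {x y} → FoldedDouble b x y → isOdd y ≡ true → y + 2 * x ≡ b
  foldedDouble-odd {x} {y} (doubled y≡2x) y-odd =
    ⊥-elim (true≢false (trans (sym y-odd) (double-isEven x y y≡2x)))
  foldedDouble-odd (reflected y+2x≡b) _ = y+2x≡b

  foldedDouble-even : ∀ {x y} → FoldedDouble b x y → isOdd y ≡ false → y ≡ 2 * x
  foldedDouble-even (doubled y≡2x) _ = y≡2x
  foldedDouble-even {x} {y} (reflected y+2x≡b) y-even =
    ⊥-elim (true≢false (trans (sym (complement-isOdd x y y+2x≡b)) y-even))

  foldedDouble-injective : ∀ {x x′ y} → FoldedDouble b x y → FoldedDouble b x′ y → x ≡ x′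
  foldedDouble-injective {x} {x′} (doubled y≡2x) (doubled y≡2x′) =
    *-cancelˡ-≡ x x′ 2 (trans (sym y≡2x) y≡2x′)
  foldedDouble-injective {x} {x′} {y} (reflected y+2x≡b) (reflected y+2x′≡b) =
    *-cancelˡ-≡ x x′ 2 (+-cancelˡ-≡ y _ _ (trans y+2x≡b (sym y+2x′≡b)))
  foldedDouble-injective {x} {x′} {y} (doubled y≡2x) (reflected y+2x′≡b) =
    ⊥-elim (true≢false (trans (sym (complement-isOdd x′ y y+2x′≡b)) (double-isEven x y y≡2x)))
  foldedDouble-injective {x} {x′} {y} (reflected y+2x≡b) (doubled y≡2x′) =
    ⊥-elim (true≢false (trans (sym (complement-isOdd x y y+2x≡b)) (double-isEven x′ y y≡2x′)))

range : ℕ → ℕ → List ℕ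
range s zero    = []
range s (suc n) = s ∷ range (suc s) n

oddPositions : (ℕ → ℕ) → ℕ → ℕ → List ℕ
oddPositions d s n = filterᵇ (isOdd ∘ d) (range s n)

map-suc-range : ∀ s n → map suc (range s n) ≡ range (suc s) n
map-suc-range s zero    = refl
map-suc-range s (suc n) = cong (suc s ∷_) (map-suc-range (suc s) n)

upTo≡range : ∀ n → upTo n ≡ range 0 n
upTo≡range zero    = refl
upTo≡range (suc n) = cong (0 ∷_) (begin
  applyUpTo suc n     ≡⟨ sym (map-upTo suc n) ⟩
  map suc (upTo n)    ≡⟨ cong (map suc) (upTo≡range n) ⟩
  map suc (range 0 n) ≡⟨ map-suc-range 0 n ⟩
  range 1 n           ∎)
  where open ≡-Reasoning

filterᵇ-map : ∀ (p : ℕ → Bool) (f : ℕ → ℕ) xs → filterᵇ p (map f xs) ≡ map f (filterᵇ (p ∘ f) xs)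
filterᵇ-map p f []       = refl
filterᵇ-map p f (x ∷ xs) with p (f x)
... | true  = cong (f x ∷_) (filterᵇ-map p f xs)
... | false = filterᵇ-map p f xs

filterᵇ-cong : ∀ {p q : ℕ → Bool} → (∀ x → p x ≡ q x) → ∀ xs → filterᵇ p xs ≡ filterᵇ q xs
filterᵇ-cong         p≗q []       = refl
filterᵇ-cong {p} {q} p≗q (x ∷ xs) rewrite p≗q x with q x
... | true  = cong (x ∷_) (filterᵇ-cong p≗q xs)
... | false = filterᵇ-cong p≗q xs

filterᵇ-accept : ∀ {p : ℕ → Bool} {x} xs → p x ≡ true → filterᵇ p (x ∷ xs) ≡ x ∷ filterᵇ p xs
filterᵇ-accept xs px rewrite px = refl

odd-values-shifted : ∀ d n → filterᵇ isOdd (map (d ∘ suc) (upTo n)) ≡ map d (oddPositions d 1 n)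
odd-values-shifted d n = begin
  filterᵇ isOdd (map (d ∘ suc) (upTo n))      ≡⟨ cong (filterᵇ isOdd) (map-∘ (upTo n)) ⟩
  filterᵇ isOdd (map d (map suc (upTo n)))    ≡⟨ cong (filterᵇ isOdd ∘ map d ∘ map suc) (upTo≡range n) ⟩
  filterᵇ isOdd (map d (map suc (range 0 n))) ≡⟨ cong (filterᵇ isOdd ∘ map d) (map-suc-range 0 n) ⟩
  filterᵇ isOdd (map d (range 1 n))           ≡⟨ filterᵇ-map isOdd d (range 1 n) ⟩
  map d (oddPositions d 1 n)                  ∎
  where open ≡-Reasoning

odd-positions-closed : ∀ d n → isOdd (d 0) ≡ true → isOdd (d n) ≡ true →
                       filterᵇ (isOdd ∘ d) (upTo n) ++ n ∷ [] ≡ 0 ∷ oddPositions d 1 n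
odd-positions-closed d n d0-odd dn-odd = begin
  filterᵇ p (upTo n) ++ n ∷ []             ≡⟨ cong (filterᵇ p (upTo n) ++_) (sym (filterᵇ-accept {p} [] dn-odd)) ⟩
  filterᵇ p (upTo n) ++ filterᵇ p (n ∷ []) ≡⟨ sym (filter-++ (T? ∘ p) (upTo n) (n ∷ [])) ⟩
  filterᵇ p (upTo n ++ n ∷ [])             ≡⟨ cong (filterᵇ p) (upTo-∷ʳ n) ⟩
  filterᵇ p (upTo (suc n))                 ≡⟨ cong (filterᵇ p) (upTo≡range (suc n)) ⟩
  filterᵇ p (0 ∷ range 1 n)                ≡⟨ filterᵇ-accept {p} (range 1 n) d0-odd ⟩
  0 ∷ oddPositions d 1 n                   ∎
  where
  open ≡-Reasoning
  p : ℕ → Bool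
  p = isOdd ∘ d

m+n≡o⇒+m≡+o-+n : ∀ {m n o} → m + n ≡ o → ℤ.+ m ≡ ℤ.+ o ℤ.- ℤ.+ n
m+n≡o⇒+m≡+o-+n {m} {n} refl = sym (begin
  ℤ.+ (m + n) ℤ.- ℤ.+ n  ≡⟨ m-n≡m⊖n (m + n) n ⟩
  (m + n) ⊖ n            ≡⟨ ⊖-≥ (m≤n+m n m) ⟩
  ℤ.+ (m + n ∸ n)        ≡⟨ cong ℤ.+_ (m+n∸n≡m m n) ⟩
  ℤ.+ m                  ∎)
  where open ≡-Reasoning

module OddDoubling {b : ℕ} (b-odd : isOdd b ≡ true) (d : ℕ → ℕ)
                   (d-step : ∀ k → FoldedDouble b (d k) (d (suc k))) where

  -- s is the last odd position so far and t the current position, so that d doubles on (s, t].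
  recurrence-from : ∀ n s t → s ≤ t → d t ≡ 2 ^ (t ∸ s) * d s →
    Recurrence b (d s) (map d (oddPositions d (suc t) n)) (diffs (s ∷ oddPositions d (suc t) n))
  recurrence-from zero    s t s≤t dt≡2^[t∸s]ds = tt
  recurrence-from (suc n) s t s≤t dt≡2^[t∸s]ds with isOdd (d (suc t)) in odd?
  ... | true  = m+n≡o⇒+m≡+o-+n odd-step ,
                recurrence-from n (suc t) (suc t) ≤-refl (sym 2^[t∸t]x≡x)
    where
    open ≡-Reasoning
    2^[t∸t]x≡x : 2 ^ (suc t ∸ suc t) * d (suc t) ≡ d (suc t)
    2^[t∸t]x≡x = trans (cong (λ e → 2 ^ e * d (suc t)) (n∸n≡0 t)) (*-identityˡ (d (suc t)))
    odd-step : d (suc t) + 2 ^ (suc t ∸ s) * d s ≡ b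
    odd-step = begin
      d (suc t) + 2 ^ (suc t ∸ s) * d s    ≡⟨ cong (λ e → d (suc t) + 2 ^ e * d s) (+-∸-assoc 1 s≤t) ⟩
      d (suc t) + 2 * 2 ^ (t ∸ s) * d s    ≡⟨ cong (d (suc t) +_) (*-assoc 2 (2 ^ (t ∸ s)) (d s)) ⟩
      d (suc t) + 2 * (2 ^ (t ∸ s) * d s)  ≡⟨ cong (λ x → d (suc t) + 2 * x) (sym dt≡2^[t∸s]ds) ⟩
      d (suc t) + 2 * d t                  ≡⟨ foldedDouble-odd b-odd (d-step t) odd? ⟩
      b                                    ∎
  ... | false = recurrence-from n s (suc t) (m≤n⇒m≤1+n s≤t) even-step
    where
    open ≡-Reasoning
    even-step : d (suc t) ≡ 2 ^ (suc t ∸ s) * d s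
    even-step = begin
      d (suc t)                ≡⟨ foldedDouble-even b-odd (d-step t) odd? ⟩
      2 * d t                  ≡⟨ cong (2 *_) dt≡2^[t∸s]ds ⟩
      2 * (2 ^ (t ∸ s) * d s)  ≡⟨ sym (*-assoc 2 (2 ^ (t ∸ s)) (d s)) ⟩
      2 ^ suc (t ∸ s) * d s    ≡⟨ cong (λ e → 2 ^ e * d s) (sym (+-∸-assoc 1 s≤t)) ⟩
      2 ^ (suc t ∸ s) * d s    ∎

  recurrence : ∀ n → Recurrence b (d 0) (map d (oddPositions d 1 n)) (diffs (0 ∷ oddPositions d 1 n))
  recurrence n = recurrence-from n 0 0 ≤-refl (sym (*-identityˡ (d 0)))

  d[1+P]≡d1⇒dP≡d0 : ∀ {P} → d (suc P) ≡ d 1 → d P ≡ d 0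
  d[1+P]≡d1⇒dP≡d0 {P} e =
    foldedDouble-injective b-odd (subst (FoldedDouble b (d P)) e (d-step P)) (d-step 0)

corollary24 : (b : ℕ) .{{_ : NonZero b}} → 3 ≤ b → Odd b →
              (a : ℕ) → InRRS* b a → Odd a →
              (P : ℕ) → IsPrimitivePeriod (cSeq b a) P →
              Recurrence b a (oddEntries b a P) (lPrime b a P)
corollary24 b _ b-odd a a∈RRS* a-odd P ((_ , period) , _) =
  subst₂ (Recurrence b a) (sym (odd-values-shifted d P)) (cong diffs (sym indices))
    (subst (λ x → Recurrence b x (map d positions) (diffs (0 ∷ positions))) d0≡a (recurrence P))
  where
  d : ℕ → ℕ
  d = cSeq b a
  positions : List ℕ
  positions = oddPositions d 1 P
  open OddDoubling (Odd⇒isOdd {b} b-odd) d (cSeq-suc b a)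
  d0≡a : d 0 ≡ a
  d0≡a = cSeq-zero b a a∈RRS*
  d0-odd : isOdd (d 0) ≡ true
  d0-odd = trans (cong isOdd d0≡a) (Odd⇒isOdd {a} a-odd)
  dP-odd : isOdd (d P) ≡ true
  dP-odd = trans (cong isOdd (d[1+P]≡d1⇒dP≡d0 {P} (period 1 (s≤s z≤n)))) d0-odd
  mds′-parity : ∀ k → isOdd (mds'Entry b a k) ≡ isOdd (d k)
  mds′-parity zero    = cong isOdd (sym d0≡a)
  mds′-parity (suc k) = refl
  indices : oddIndices' b a P ≡ 0 ∷ positions
  indices = trans (cong (_++ P ∷ []) (filterᵇ-cong mds′-parity (upTo P)))
                  (odd-positions-closed d P d0-odd dP-odd)
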